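{- Let $n,m$ be positive integers and let $A$ be an arbitrary $n\times m$ binary matrix. Then: (a) If $s\ge 1$ and $X_1,\dots,X_s\in\mathcal{T}_n$ are such that $r(X_1X_2\cdots X_sA)<r(X_2X_3\cdots X_sA)<\dots<r(X_sA)<r(A)$, then $c(X_1X_2\cdots X_sA)<c(A)$. (b) If $t\ge 1$ and $Y_1,\dots,Y_t\in\mathcal{T}_m$ are such that $c(AY_1Y_2\cdots Y_t)<c(AY_2Y_3\cdots Y_t)<\dots<c(AY_t)<c(A)$, then $r(AY_1Y_2\cdots Y_t)<r(A)$.
   Context: A binary matrix is a matrix with entries in $\{0,1\}$. For an $n\times m$ binary matrix $A=[a_{ij}]$, let $r(A)=\langle x_1,\dots,x_n\rangle$ where $x_i$ is the natural number whose binary representation is $a_{i1}a_{i2}\cdots a_{im}$ (so $a_{i1}$ is the most significant bit), and let $c(A)=\langle y_1,\dots,y_m\rangle$ where $y_j$ is the natural number whose binary representation is $a_{1j}a_{2j}\cdots a_{nj}$ (so $a_{1j}$ is the most significant bit). The symbol $<$ between such tuples denotes the (strict) lexicographic order on ordered tuples of integers of the same length. $\mathcal{T}_k$ denotes the set of $k\times k$ transposition matrices, i.e. permutation matrices obtained from the identity by swapping exactly two rows; multiplying a matrix on the left by an element of $\mathcal{T}_n$ swaps exactly two of its rows, and multiplying on the right by an element of $\mathcal{T}_m$ swaps exactly two of its columns. -}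

module Defs where

open import Data.Nat using (ℕ; zero; suc; _+_; _*_; _<_; _≤_)
open import Data.Fin using (Fin; zero; suc; toℕ)
open import Data.Fin.Properties using () renaming (_≟_ to _≟ᶠ_)
open import Data.List using (List; []; _∷_; length)
open import Data.Unit using (⊤)
open import Data.Vec using (Vec; []; _∷_; tabulate)
open import Data.Product using (Σ; ∃; _×_; _,_)
open import Relation.Binary.PropositionalEquality using (_≡_)
open import Relation.Nullary using (¬_; yes; no)

Mat : ℕ → ℕ → Set
Mat n m = Fin n → Fin m → ℕ

IsBinary : ∀ {n m} → Mat n m → Set
IsBinary {n} {m} A = ∀ (i : Fin n) (j : Fin m) → (A i j ≡ 0) Data.Sum.⊎ (A i j ≡ 1)
  where import Data.Sum

sumFin : ∀ k → (Fin k → ℕ) → ℕ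
sumFin zero    f = 0
sumFin (suc k) f = f zero + sumFin k (λ i → f (suc i))

_⊗_ : ∀ {n k m} → Mat n k → Mat k m → Mat n m
_⊗_ {k = k} A B i j = sumFin k (λ l → A i l * B l j)

I : ∀ k → Mat k k
I k i j with i ≟ᶠ j
... | yes _ = 1
... | no  _ = 0

-- Value of a bit string read with the first entry most significant.
binVal : ∀ k → (Fin k → ℕ) → ℕ
binVal zero    f = 0
binVal (suc k) f = f zero * 2 Data.Nat.^ k + binVal k (λ i → f (suc i))

r : ∀ {n m} → Mat n m → Vec ℕ n
r {n} {m} A = tabulate (λ i → binVal m (A i))

c : ∀ {n m} → Mat n m → Vec ℕ m
c {n} {m} A = tabulate (λ j → binVal n (λ i → A i j))

data _<ₗ_ : ∀ {k} → Vec ℕ k → Vec ℕ k → Set where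
  here : ∀ {k x y} {xs ys : Vec ℕ k} → x < y → (x ∷ xs) <ₗ (y ∷ ys)
  there : ∀ {k x} {xs ys : Vec ℕ k} → xs <ₗ ys → (x ∷ xs) <ₗ (x ∷ ys)

swapMat : ∀ {k} → Fin k → Fin k → Mat k k
swapMat {k} a b i j with i ≟ᶠ a | i ≟ᶠ b
... | yes _ | _     = I k b j
... | no _  | yes _ = I k a j
... | no _  | no _  = I k i j

IsTransposition : ∀ {k} → Mat k k → Set
IsTransposition {k} T = Σ (Fin k) λ a → Σ (Fin k) λ b →
  ¬ (a ≡ b) × (∀ i j → T i j ≡ swapMat a b i j)

prodM : ∀ {k} → List (Mat k k) → Mat k k
prodM {k} []       = I k
prodM     (X ∷ Xs) = X ⊗ prodM Xs

RowChain : ∀ {n m} → List (Mat n n) → Mat n m → Set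
RowChain []       A = ⊤
RowChain (X ∷ Xs) A = (r (prodM (X ∷ Xs) ⊗ A) <ₗ r (prodM Xs ⊗ A)) × RowChain Xs A

ColChain : ∀ {n m} → Mat n m → List (Mat m m) → Set
ColChain A []       = ⊤
ColChain A (Y ∷ Ys) = (c (A ⊗ prodM (Y ∷ Ys)) <ₗ c (A ⊗ prodM Ys)) × ColChain A Ys

-- Swapping two rows a < b of a binary matrix decreases the tuple of row values exactly
-- when row b is the smaller binary number, i.e. when at the first column j where rows a
-- and b differ, row a has a 1 and row b a 0.  The columns before j are untouched by the
-- swap, and column j loses its 1 in row a while its rows above a stay the same, so the
-- tuple of column values decreases too.  Each link of the chain in (a) is such a swap,
-- and (b) is the same statement for the transpose, once the column swap performed by Y₁
-- in A Y₁ Y₂ ⋯ Yₜ is rewritten as a swap of columns of A Y₂ ⋯ Yₜ.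
module Submission where

open import Defs
open import Data.Nat using (ℕ; zero; suc; _+_; _*_; _<_; _≤_; _≥_; _^_; z≤n; s≤s)
open import Data.Nat.Properties
open import Data.Fin using (Fin; zero; suc; toℕ)
open import Data.Fin.Properties using (toℕ-injective) renaming (_≟_ to _≟ᶠ_)
open import Data.Fin.Permutation
  using (Permutation′; permutation; _⟨$⟩ʳ_; _⟨$⟩ˡ_; _∘ₚ_; id; inverseˡ; inverseʳ)
open import Data.List using (List; []; _∷_; length)
open import Data.List.Relation.Unary.All using (All; []; _∷_)
open import Data.Vec using (Vec; _∷_; tabulate)
open import Data.Vec.Properties using (tabulate-cong)
open import Data.Product using (_×_; _,_)
open import Data.Sum using (_⊎_; inj₁; inj₂)
open import Function using (_∘_)
open import Relation.Binary.PropositionalEquality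
open import Relation.Binary.Definitions using (tri<; tri≈; tri>)
open import Relation.Nullary using (¬_; yes; no; contradiction)

record FirstDifference {k} (f g : Fin k → ℕ) : Set where
  constructor firstDifference
  field
    at    : Fin k
    agree : ∀ q → toℕ q < toℕ at → f q ≡ g q
    less  : f at < g at

firstDifference-suc : ∀ {k} {f g : Fin (suc k) → ℕ} → f zero ≡ g zero →
  FirstDifference (f ∘ suc) (g ∘ suc) → FirstDifference f g
firstDifference-suc {f = f} {g} f₀≡g₀ (firstDifference p agree less) =
  firstDifference (suc p) agree′ less
  where
  agree′ : ∀ q → toℕ q < toℕ (suc p) → f q ≡ g q
  agree′ zero    _         = f₀≡g₀
  agree′ (suc q) (s≤s q<p) = agree q q<p

firstDifference-pred : ∀ {k} {f g : Fin (suc k) → ℕ} {p : Fin k} →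
  (∀ q → toℕ q < toℕ (suc p) → f q ≡ g q) → f (suc p) < g (suc p) →
  FirstDifference (f ∘ suc) (g ∘ suc)
firstDifference-pred {p = p} agree less = firstDifference p (λ q → agree (suc q) ∘ s≤s) less

<ₗ-uncons : ∀ {k x y} {xs ys : Vec ℕ k} → (x ∷ xs) <ₗ (y ∷ ys) → x < y ⊎ (x ≡ y × xs <ₗ ys)
<ₗ-uncons (here x<y)    = inj₁ x<y
<ₗ-uncons (there xs<ys) = inj₂ (refl , xs<ys)

<ₗ-trans : ∀ {k} {xs ys zs : Vec ℕ k} → xs <ₗ ys → ys <ₗ zs → xs <ₗ zs
<ₗ-trans (here x<y)    (here y<z)    = here (<-trans x<y y<z)
<ₗ-trans (here x<y)    (there _)     = here x<y
<ₗ-trans (there _)     (here y<z)    = here y<z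
<ₗ-trans (there xs<ys) (there ys<zs) = there (<ₗ-trans xs<ys ys<zs)

<ₗ⇒firstDifference : ∀ {k} {f g : Fin k → ℕ} → tabulate f <ₗ tabulate g → FirstDifference f g
<ₗ⇒firstDifference {suc k} lt with <ₗ-uncons lt
... | inj₁ f₀<g₀           = firstDifference zero (λ _ ()) f₀<g₀
... | inj₂ (f₀≡g₀ , tail<) = firstDifference-suc f₀≡g₀ (<ₗ⇒firstDifference tail<)

firstDifference⇒<ₗ : ∀ {k} {f g : Fin k → ℕ} → FirstDifference f g → tabulate f <ₗ tabulate g
firstDifference⇒<ₗ (firstDifference zero _ less) = here less
firstDifference⇒<ₗ {f = f} {g} (firstDifference (suc p) agree less) =
  subst (λ y → (f zero ∷ tabulate (f ∘ suc)) <ₗ (y ∷ tabulate (g ∘ suc)))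
    (agree zero (s≤s z≤n))
    (there (firstDifference⇒<ₗ (firstDifference-pred agree less)))

Bits : ∀ {k} → (Fin k → ℕ) → Set
Bits f = ∀ i → f i ≡ 0 ⊎ f i ≡ 1

bit≤1 : ∀ {x} → x ≡ 0 ⊎ x ≡ 1 → x ≤ 1
bit≤1 (inj₁ refl) = z≤n
bit≤1 (inj₂ refl) = s≤s z≤n

binVal-cong : ∀ k {f g : Fin k → ℕ} → (∀ i → f i ≡ g i) → binVal k f ≡ binVal k g
binVal-cong zero    f≗g = refl
binVal-cong (suc k) f≗g = cong₂ (λ x y → x * 2 ^ k + y) (f≗g zero) (binVal-cong k (f≗g ∘ suc))

binVal-< : ∀ k {f : Fin k → ℕ} → Bits f → binVal k f < 2 ^ k
binVal-<-head : ∀ k {f : Fin (suc k) → ℕ} → Bits f → binVal (suc k) f < suc (f zero) * 2 ^ k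

binVal-< zero    _ = s≤s z≤n
binVal-< (suc k) {f} bits = begin-strict
  binVal (suc k) f      <⟨ binVal-<-head k bits ⟩
  suc (f zero) * 2 ^ k  ≤⟨ *-monoˡ-≤ (2 ^ k) (s≤s (bit≤1 (bits zero))) ⟩
  2 * 2 ^ k             ∎
  where open ≤-Reasoning

binVal-<-head k {f} bits = begin-strict
  f zero * 2 ^ k + binVal k (f ∘ suc)  <⟨ +-monoʳ-< (f zero * 2 ^ k) (binVal-< k (bits ∘ suc)) ⟩
  f zero * 2 ^ k + 2 ^ k               ≡⟨ +-comm (f zero * 2 ^ k) (2 ^ k) ⟩
  suc (f zero) * 2 ^ k                 ∎
  where open ≤-Reasoning

binVal-<⇒firstDifference : ∀ k {f g : Fin k → ℕ} → Bits g →
  binVal k f < binVal k g → FirstDifference f g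
binVal-<⇒firstDifference (suc k) {f} {g} bits lt with <-cmp (f zero) (g zero)
... | tri< f₀<g₀ _ _ = firstDifference zero (λ _ ()) f₀<g₀
... | tri≈ _ f₀≡g₀ _ =
  firstDifference-suc f₀≡g₀ (binVal-<⇒firstDifference k (bits ∘ suc) tail<)
  where
  tail< : binVal k (f ∘ suc) < binVal k (g ∘ suc)
  tail< = +-cancelˡ-< (g zero * 2 ^ k) _ _
    (subst (λ x → x * 2 ^ k + binVal k (f ∘ suc) < binVal (suc k) g) f₀≡g₀ lt)
... | tri> _ _ g₀<f₀ = contradiction lt (<-asym g<f)
  where
  open ≤-Reasoning
  g<f : binVal (suc k) g < binVal (suc k) f
  g<f = begin-strict
    binVal (suc k) g      <⟨ binVal-<-head k bits ⟩
    suc (g zero) * 2 ^ k  ≤⟨ *-monoˡ-≤ (2 ^ k) g₀<f₀ ⟩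
    f zero * 2 ^ k        ≤⟨ m≤m+n (f zero * 2 ^ k) (binVal k (f ∘ suc)) ⟩
    binVal (suc k) f      ∎

firstDifference⇒binVal-< : ∀ k {f g : Fin k → ℕ} → Bits f →
  FirstDifference f g → binVal k f < binVal k g
firstDifference⇒binVal-< (suc k) {f} {g} bits (firstDifference zero _ f₀<g₀) = begin-strict
  binVal (suc k) f      <⟨ binVal-<-head k bits ⟩
  suc (f zero) * 2 ^ k  ≤⟨ *-monoˡ-≤ (2 ^ k) f₀<g₀ ⟩
  g zero * 2 ^ k        ≤⟨ m≤m+n (g zero * 2 ^ k) (binVal k (g ∘ suc)) ⟩
  binVal (suc k) g      ∎
  where open ≤-Reasoning
firstDifference⇒binVal-< (suc k) {f} {g} bits (firstDifference (suc p) agree less) =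
  subst (λ x → binVal (suc k) f < x * 2 ^ k + binVal k (g ∘ suc)) (agree zero (s≤s z≤n))
    (+-monoʳ-< (f zero * 2 ^ k)
      (firstDifference⇒binVal-< k (bits ∘ suc) (firstDifference-pred agree less)))

binary-reindex : ∀ {n m n′ m′} {M : Mat n m} {N : Mat n′ m′}
  (ρ : Fin n′ → Fin n) (κ : Fin m′ → Fin m) →
  (∀ i j → N i j ≡ M (ρ i) (κ j)) → IsBinary M → IsBinary N
binary-reindex ρ κ N≗ binary i j =
  subst (λ x → x ≡ 0 ⊎ x ≡ 1) (sym (N≗ i j)) (binary (ρ i) (κ j))

r-cong : ∀ {n m} {M N : Mat n m} → (∀ i j → M i j ≡ N i j) → r M ≡ r N
r-cong {m = m} M≗N = tabulate-cong (λ i → binVal-cong m (M≗N i))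

c-cong : ∀ {n m} {M N : Mat n m} → (∀ i j → M i j ≡ N i j) → c M ≡ c N
c-cong {n = n} M≗N = tabulate-cong (λ j → binVal-cong n (λ i → M≗N i j))

I-refl : ∀ {k} (i : Fin k) → I k i i ≡ 1
I-refl i with i ≟ᶠ i
... | yes _   = refl
... | no i≢i = contradiction refl i≢i

I-≢ : ∀ {k} {i j : Fin k} → ¬ i ≡ j → I k i j ≡ 0
I-≢ {i = i} {j} i≢j with i ≟ᶠ j
... | yes i≡j = contradiction i≡j i≢j
... | no _    = refl

I-suc : ∀ {k} (i j : Fin k) → I (suc k) (suc i) (suc j) ≡ I k i j
I-suc i j with i ≟ᶠ j
... | yes _ = refl
... | no _  = refl

sumFin-cong : ∀ k {f g : Fin k → ℕ} → (∀ i → f i ≡ g i) → sumFin k f ≡ sumFin k g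
sumFin-cong zero    f≗g = refl
sumFin-cong (suc k) f≗g = cong₂ _+_ (f≗g zero) (sumFin-cong k (f≗g ∘ suc))

sumFin-zero : ∀ k {f : Fin k → ℕ} → (∀ i → f i ≡ 0) → sumFin k f ≡ 0
sumFin-zero zero    f≗0 = refl
sumFin-zero (suc k) f≗0 = cong₂ _+_ (f≗0 zero) (sumFin-zero k (f≗0 ∘ suc))

sumFin-I-* : ∀ k (p : Fin k) (f : Fin k → ℕ) → sumFin k (λ l → I k p l * f l) ≡ f p
sumFin-I-* (suc k) zero f = begin
  1 * f zero + sumFin k (λ _ → 0)
    ≡⟨ cong₂ _+_ (*-identityˡ (f zero)) (sumFin-zero k (λ _ → refl)) ⟩
  f zero + 0
    ≡⟨ +-identityʳ (f zero) ⟩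
  f zero                            ∎
  where open ≡-Reasoning
sumFin-I-* (suc k) (suc p) f =
  trans (sumFin-cong k (λ l → cong (_* f (suc l)) (I-suc p l))) (sumFin-I-* k p (f ∘ suc))

sumFin-*-I : ∀ k (q : Fin k) (f : Fin k → ℕ) → sumFin k (λ l → f l * I k l q) ≡ f q
sumFin-*-I (suc k) zero f = begin
  f zero * 1 + sumFin k (λ l → f (suc l) * 0)
    ≡⟨ cong₂ _+_ (*-identityʳ (f zero)) (sumFin-zero k (*-zeroʳ ∘ f ∘ suc)) ⟩
  f zero + 0
    ≡⟨ +-identityʳ (f zero) ⟩
  f zero                                        ∎
  where open ≡-Reasoning
sumFin-*-I (suc k) (suc q) f = begin
  f zero * 0 + sumFin k (λ l → f (suc l) * I (suc k) (suc l) (suc q))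
    ≡⟨ cong₂ _+_ (*-zeroʳ (f zero)) (sumFin-cong k (λ l → cong (f (suc l) *_) (I-suc l q))) ⟩
  sumFin k (λ l → f (suc l) * I k l q)
    ≡⟨ sumFin-*-I k q (f ∘ suc) ⟩
  f (suc q) ∎
  where open ≡-Reasoning

⊗-identityˡ : ∀ {n m} (A : Mat n m) i j → (I n ⊗ A) i j ≡ A i j
⊗-identityˡ {n} A i j = sumFin-I-* n i (λ l → A l j)

⊗-identityʳ : ∀ {n m} (A : Mat n m) i j → (A ⊗ I m) i j ≡ A i j
⊗-identityʳ {m = m} A i j = sumFin-*-I m j (A i)

record IsSwap {k} (σ : Fin k → Fin k) (a b : Fin k) : Set where
  field
    distinct : ¬ a ≡ b
    maps-a   : σ a ≡ b
    maps-b   : σ b ≡ a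
    fixes    : ∀ i → ¬ i ≡ a → ¬ i ≡ b → σ i ≡ i

IsSwap-sym : ∀ {k} {σ : Fin k → Fin k} {a b} → IsSwap σ a b → IsSwap σ b a
IsSwap-sym sw = record
  { distinct = distinct ∘ sym ; maps-a = maps-b ; maps-b = maps-a
  ; fixes    = λ i i≢b i≢a → fixes i i≢a i≢b }
  where open IsSwap sw

IsSwap-involutive : ∀ {k} {σ : Fin k → Fin k} {a b} → IsSwap σ a b → ∀ i → σ (σ i) ≡ i
IsSwap-involutive {σ = σ} {a} {b} sw i with i ≟ᶠ a | i ≟ᶠ b
... | yes refl | _        = trans (cong σ maps-a) maps-b
  where open IsSwap sw
... | no _     | yes refl = trans (cong σ maps-b) maps-a
  where open IsSwap sw
... | no i≢a   | no i≢b   = trans (cong σ (fixes i i≢a i≢b)) (fixes i i≢a i≢b)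
  where open IsSwap sw

IsSwap-conjugate : ∀ {k} {σ : Fin k → Fin k} {a b} (π : Permutation′ k) → IsSwap σ a b →
  IsSwap (λ i → π ⟨$⟩ˡ σ (π ⟨$⟩ʳ i)) (π ⟨$⟩ˡ a) (π ⟨$⟩ˡ b)
IsSwap-conjugate {σ = σ} {a} {b} π sw = record
  { distinct = λ a′≡b′ →
      distinct (trans (sym (inverseʳ π)) (trans (cong (π ⟨$⟩ʳ_) a′≡b′) (inverseʳ π)))
  ; maps-a   = trans (cong (λ x → π ⟨$⟩ˡ σ x) (inverseʳ π)) (cong (π ⟨$⟩ˡ_) maps-a)
  ; maps-b   = trans (cong (λ x → π ⟨$⟩ˡ σ x) (inverseʳ π)) (cong (π ⟨$⟩ˡ_) maps-b)
  ; fixes    = λ i i≢a′ i≢b′ →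
      trans (cong (π ⟨$⟩ˡ_) (fixes (π ⟨$⟩ʳ i) (moved i≢a′) (moved i≢b′))) (inverseˡ π)
  }
  where
  open IsSwap sw
  moved : ∀ {i x} → ¬ i ≡ π ⟨$⟩ˡ x → ¬ π ⟨$⟩ʳ i ≡ x
  moved i≢x πi≡x = i≢x (trans (sym (inverseˡ π)) (cong (π ⟨$⟩ˡ_) πi≡x))

I-involution : ∀ {k} {σ : Fin k → Fin k} → (∀ i → σ (σ i) ≡ i) →
  ∀ l x → I k (σ l) x ≡ I k l (σ x)
I-involution {k} {σ} σσ≗id l x with l ≟ᶠ σ x
... | yes refl = trans (cong (λ y → I k y x) (σσ≗id x)) (I-refl x)
... | no l≢σx  = I-≢ (λ σl≡x → l≢σx (trans (sym (σσ≗id l)) (cong σ σl≡x)))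

swap : ∀ {k} → Fin k → Fin k → Fin k → Fin k
swap a b i with i ≟ᶠ a | i ≟ᶠ b
... | yes _ | _     = b
... | no _  | yes _ = a
... | no _  | no _  = i

swap-isSwap : ∀ {k} {a b : Fin k} → ¬ a ≡ b → IsSwap (swap a b) a b
swap-isSwap {a = a} {b} a≢b = record
  { distinct = a≢b ; maps-a = maps-a ; maps-b = maps-b ; fixes = fixes }
  where
  maps-a : swap a b a ≡ b
  maps-a with a ≟ᶠ a
  ... | yes _   = refl
  ... | no a≢a = contradiction refl a≢a
  maps-b : swap a b b ≡ a
  maps-b with b ≟ᶠ a | b ≟ᶠ b
  ... | yes b≡a | _      = b≡a
  ... | no _    | yes _  = refl
  ... | no _    | no b≢b = contradiction refl b≢b
  fixes : ∀ i → ¬ i ≡ a → ¬ i ≡ b → swap a b i ≡ i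
  fixes i i≢a i≢b with i ≟ᶠ a | i ≟ᶠ b
  ... | yes i≡a | _       = contradiction i≡a i≢a
  ... | no _    | yes i≡b = contradiction i≡b i≢b
  ... | no _    | no _    = refl

swapMat-swap : ∀ {k} (a b i j : Fin k) → swapMat a b i j ≡ I k (swap a b i) j
swapMat-swap a b i j with i ≟ᶠ a | i ≟ᶠ b
... | yes _ | _     = refl
... | no _  | yes _ = refl
... | no _  | no _  = refl

transposition-⊗ : ∀ {k m} {X : Mat k k} {a b : Fin k} → (∀ i j → X i j ≡ swapMat a b i j) →
  (B : Mat k m) → ∀ i j → (X ⊗ B) i j ≡ B (swap a b i) j
transposition-⊗ {k} {a = a} {b} X≗ B i j =
  trans (sumFin-cong k (λ l → cong (_* B l j) (trans (X≗ i l) (swapMat-swap a b i l))))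
        (sumFin-I-* k (swap a b i) (λ l → B l j))

swapRows-c<ₗ : ∀ {n m} {M N : Mat n m} {σ : Fin n → Fin n} {a b : Fin n} →
  IsSwap σ a b → toℕ a < toℕ b → IsBinary M → (∀ i j → N i j ≡ M (σ i) j) →
  FirstDifference (M b) (M a) → c N <ₗ c M
swapRows-c<ₗ {n} {M = M} {N} {σ} {a} {b} sw a<b binary N≗
  (firstDifference j₀ rows-agree Mbj₀<Maj₀) =
  firstDifference⇒<ₗ (firstDifference j₀ columns-agree column-less)
  where
  open IsSwap sw
  column-unchanged : ∀ j → toℕ j < toℕ j₀ → ∀ i → N i j ≡ M i j
  column-unchanged j j<j₀ i with i ≟ᶠ a | i ≟ᶠ b
  ... | yes refl | _        = trans (N≗ i j) (trans (cong (λ x → M x j) maps-a) (rows-agree j j<j₀))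
  ... | no _     | yes refl = trans (N≗ i j) (trans (cong (λ x → M x j) maps-b) (sym (rows-agree j j<j₀)))
  ... | no i≢a   | no i≢b   = trans (N≗ i j) (cong (λ x → M x j) (fixes i i≢a i≢b))
  columns-agree : ∀ j → toℕ j < toℕ j₀ → binVal n (λ i → N i j) ≡ binVal n (λ i → M i j)
  columns-agree j j<j₀ = binVal-cong n (column-unchanged j j<j₀)
  rows-above-unchanged : ∀ q → toℕ q < toℕ a → N q j₀ ≡ M q j₀
  rows-above-unchanged q q<a = trans (N≗ q j₀) (cong (λ x → M x j₀) (fixes q
    (λ q≡a → <-irrefl (cong toℕ q≡a) q<a) (λ q≡b → <-irrefl (cong toℕ q≡b) (<-trans q<a a<b))))
  column-less : binVal n (λ i → N i j₀) < binVal n (λ i → M i j₀)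
  column-less = firstDifference⇒binVal-< n (λ i → binary-reindex σ (λ j → j) N≗ binary i j₀)
    (firstDifference a rows-above-unchanged
      (subst (_< M a j₀) (sym (trans (N≗ a j₀) (cong (λ x → M x j₀) maps-a))) Mbj₀<Maj₀))

swapRows-c<ₗ-at : ∀ {n m} {M N : Mat n m} {σ : Fin n → Fin n} {a b : Fin n} →
  IsSwap σ a b → IsBinary M → (∀ i j → N i j ≡ M (σ i) j) →
  (∀ q → toℕ q < toℕ a → binVal m (N q) ≡ binVal m (M q)) → binVal m (N a) < binVal m (M a) →
  c N <ₗ c M
swapRows-c<ₗ-at {m = m} {M} {N} {σ} {a} {b} sw binary N≗ rows-agree Na<Ma =
  swapRows-c<ₗ sw a<b binary N≗ (binVal-<⇒firstDifference m (binary a) Mb<Ma)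
  where
  open IsSwap sw
  row-moved : ∀ i → binVal m (N i) ≡ binVal m (M (σ i))
  row-moved i = binVal-cong m (N≗ i)
  Mb<Ma : binVal m (M b) < binVal m (M a)
  Mb<Ma = subst (λ x → binVal m (M x) < binVal m (M a)) maps-a
    (subst (_< binVal m (M a)) (row-moved a) Na<Ma)
  a<b : toℕ a < toℕ b
  a<b with <-cmp (toℕ a) (toℕ b)
  ... | tri< a<b _ _ = a<b
  ... | tri≈ _ a≡b _ = contradiction (toℕ-injective a≡b) distinct
  ... | tri> _ _ b<a = contradiction Mb<Ma (<-irrefl
    (trans (sym (rows-agree b b<a)) (trans (row-moved b) (cong (binVal m ∘ M) maps-b))))

swapRows-r<ₗ⇒c<ₗ : ∀ {n m} {M N : Mat n m} {σ : Fin n → Fin n} {a b : Fin n} →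
  IsSwap σ a b → IsBinary M → (∀ i j → N i j ≡ M (σ i) j) → r N <ₗ r M → c N <ₗ c M
swapRows-r<ₗ⇒c<ₗ {m = m} {M} {a = a} {b} sw binary N≗ r< with <ₗ⇒firstDifference r<
... | firstDifference p agree less with p ≟ᶠ a | p ≟ᶠ b
... | yes refl | _        = swapRows-c<ₗ-at sw binary N≗ agree less
... | no _     | yes refl = swapRows-c<ₗ-at (IsSwap-sym sw) binary N≗ agree less
... | no p≢a   | no p≢b   = contradiction
  (binVal-cong m (λ j → trans (N≗ p j) (cong (λ x → M x j) (IsSwap.fixes sw p p≢a p≢b))))
  (<⇒≢ less)

swapPermutation : ∀ {k} {σ : Fin k → Fin k} {a b} → IsSwap σ a b → Permutation′ k
swapPermutation {σ = σ} sw = permutation σ σ (IsSwap-involutive sw) (IsSwap-involutive sw)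

columnPermutation : ∀ {m} {Ys : List (Mat m m)} → All IsTransposition Ys → Permutation′ m
columnPermutation []                       = id
columnPermutation ((_ , _ , a≢b , _) ∷ ts) = columnPermutation ts ∘ₚ swapPermutation (swap-isSwap a≢b)

prodM-columnPermutation : ∀ {m} {Ys : List (Mat m m)} (ts : All IsTransposition Ys) →
  ∀ l j → prodM Ys l j ≡ I m l (columnPermutation ts ⟨$⟩ʳ j)
prodM-columnPermutation []                              l j = refl
prodM-columnPermutation {m} {Y ∷ Ys} ((a , b , a≢b , Y≗) ∷ ts) l j = begin
  (Y ⊗ prodM Ys) l j             ≡⟨ transposition-⊗ Y≗ (prodM Ys) l j ⟩
  prodM Ys (swap a b l) j        ≡⟨ prodM-columnPermutation ts (swap a b l) j ⟩
  I m (swap a b l) (π ⟨$⟩ʳ j)    ≡⟨ I-involution (IsSwap-involutive (swap-isSwap a≢b)) l (π ⟨$⟩ʳ j) ⟩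
  I m l (swap a b (π ⟨$⟩ʳ j))    ∎
  where
  open ≡-Reasoning
  π : Permutation′ m
  π = columnPermutation ts

module _ {n m : ℕ} (A : Mat n m) (binary : IsBinary A) where

  transposition-prodM⊗ : ∀ {X : Mat n n} {a b} Xs → (∀ i j → X i j ≡ swapMat a b i j) →
    ∀ i j → (prodM (X ∷ Xs) ⊗ A) i j ≡ (prodM Xs ⊗ A) (swap a b i) j
  transposition-prodM⊗ Xs X≗ i j =
    sumFin-cong n (λ l → cong (_* A l j) (transposition-⊗ X≗ (prodM Xs) i l))

  prodM⊗-binary : ∀ {Xs} → All IsTransposition Xs → IsBinary (prodM Xs ⊗ A)
  prodM⊗-binary []                               =
    binary-reindex (λ i → i) (λ j → j) (⊗-identityˡ A) binary
  prodM⊗-binary {_ ∷ Xs} ((a , b , _ , X≗) ∷ ts) =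
    binary-reindex (swap a b) (λ j → j) (transposition-prodM⊗ Xs X≗) (prodM⊗-binary ts)

  rowStep-c<ₗ : ∀ {X Xs} → All IsTransposition (X ∷ Xs) →
    r (prodM (X ∷ Xs) ⊗ A) <ₗ r (prodM Xs ⊗ A) → c (prodM (X ∷ Xs) ⊗ A) <ₗ c (prodM Xs ⊗ A)
  rowStep-c<ₗ {Xs = Xs} ((_ , _ , a≢b , X≗) ∷ ts) =
    swapRows-r<ₗ⇒c<ₗ (swap-isSwap a≢b) (prodM⊗-binary ts) (transposition-prodM⊗ Xs X≗)

  rowChain-c<ₗ : ∀ X Xs → All IsTransposition (X ∷ Xs) → RowChain (X ∷ Xs) A →
    c (prodM (X ∷ Xs) ⊗ A) <ₗ c (I n ⊗ A)
  rowChain-c<ₗ X []       ts           (r< , _)     = rowStep-c<ₗ ts r<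
  rowChain-c<ₗ X (Y ∷ Ys) ts@(_ ∷ ts′) (r< , chain) =
    <ₗ-trans (rowStep-c<ₗ ts r<) (rowChain-c<ₗ Y Ys ts′ chain)

  ⊗prodM-columnPermutation : ∀ {Ys} (ts : All IsTransposition Ys) →
    ∀ i j → (A ⊗ prodM Ys) i j ≡ A i (columnPermutation ts ⟨$⟩ʳ j)
  ⊗prodM-columnPermutation ts i j =
    trans (sumFin-cong m (λ l → cong (A i l *_) (prodM-columnPermutation ts l j)))
          (sumFin-*-I m (columnPermutation ts ⟨$⟩ʳ j) (A i))

  ⊗prodM-binary : ∀ {Ys} → All IsTransposition Ys → IsBinary (A ⊗ prodM Ys)
  ⊗prodM-binary ts =
    binary-reindex (λ i → i) (columnPermutation ts ⟨$⟩ʳ_) (⊗prodM-columnPermutation ts) binary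

  -- A Y₁ P is A P with two columns swapped, the swap being Y₁ conjugated by the permutation P.
  columnStep-r<ₗ : ∀ {Y Ys} → All IsTransposition (Y ∷ Ys) →
    c (A ⊗ prodM (Y ∷ Ys)) <ₗ c (A ⊗ prodM Ys) → r (A ⊗ prodM (Y ∷ Ys)) <ₗ r (A ⊗ prodM Ys)
  columnStep-r<ₗ {Y} {Ys} ts@((a , b , a≢b , _) ∷ ts′) =
    swapRows-r<ₗ⇒c<ₗ {M = λ j i → (A ⊗ prodM Ys) i j} {N = λ j i → (A ⊗ prodM (Y ∷ Ys)) i j}
      (IsSwap-conjugate π (swap-isSwap a≢b)) (λ j i → ⊗prodM-binary ts′ i j) columns-swapped
    where
    π : Permutation′ m
    π = columnPermutation ts′
    columns-swapped : ∀ j i →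
      (A ⊗ prodM (Y ∷ Ys)) i j ≡ (A ⊗ prodM Ys) i (π ⟨$⟩ˡ swap a b (π ⟨$⟩ʳ j))
    columns-swapped j i = begin
      (A ⊗ prodM (Y ∷ Ys)) i j                      ≡⟨ ⊗prodM-columnPermutation ts i j ⟩
      A i (swap a b (π ⟨$⟩ʳ j))                     ≡⟨ cong (A i) (inverseʳ π) ⟨
      A i (π ⟨$⟩ʳ (π ⟨$⟩ˡ swap a b (π ⟨$⟩ʳ j)))     ≡⟨ ⊗prodM-columnPermutation ts′ i _ ⟨
      (A ⊗ prodM Ys) i (π ⟨$⟩ˡ swap a b (π ⟨$⟩ʳ j)) ∎
      where open ≡-Reasoning

  columnChain-r<ₗ : ∀ Y Ys → All IsTransposition (Y ∷ Ys) → ColChain A (Y ∷ Ys) →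
    r (A ⊗ prodM (Y ∷ Ys)) <ₗ r (A ⊗ I m)
  columnChain-r<ₗ Y []       ts           (c< , _)     = columnStep-r<ₗ ts c<
  columnChain-r<ₗ Y (Z ∷ Zs) ts@(_ ∷ ts′) (c< , chain) =
    <ₗ-trans (columnStep-r<ₗ ts c<) (columnChain-r<ₗ Z Zs ts′ chain)

theorem1 : (n m : ℕ) → n ≥ 1 → m ≥ 1 → (A : Mat n m) → IsBinary A →
    ((Xs : List (Mat n n)) → length Xs ≥ 1 → All IsTransposition Xs →
      RowChain Xs A → c (prodM Xs ⊗ A) <ₗ c A)
    × ((Ys : List (Mat m m)) → length Ys ≥ 1 → All IsTransposition Ys →
      ColChain A Ys → r (A ⊗ prodM Ys) <ₗ r A)
theorem1 n m _ _ A binary = partA , partB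
  where
  partA : (Xs : List (Mat n n)) → length Xs ≥ 1 → All IsTransposition Xs →
    RowChain Xs A → c (prodM Xs ⊗ A) <ₗ c A
  partA (X ∷ Xs) _ ts chain =
    subst (c (prodM (X ∷ Xs) ⊗ A) <ₗ_) (c-cong (⊗-identityˡ A))
      (rowChain-c<ₗ A binary X Xs ts chain)
  partB : (Ys : List (Mat m m)) → length Ys ≥ 1 → All IsTransposition Ys →
    ColChain A Ys → r (A ⊗ prodM Ys) <ₗ r A
  partB (Y ∷ Ys) _ ts chain =
    subst (r (A ⊗ prodM (Y ∷ Ys)) <ₗ_) (r-cong (⊗-identityʳ A))
      (columnChain-r<ₗ A binary Y Ys ts chain)
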